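{- Let $\mathcal M=(Q,s_{in},s_T,s_F,\delta)$ be a deterministic binary Turing machine with input. There is a term $\mathtt{init}$ of $\Lambda_{\tt det}$ such that for every term $k$ and every input string $i = \mathsf{L}\cdot s\cdot\mathsf{R}\in\{0,1,\mathsf{L},\mathsf{R}\}^*$ with $s\in\{0,1\}^*$, $$\mathtt{init}\, k\, \lceil i\rceil \rightarrow_{det}^{\Theta(1)} k\, \lceil C_{in}(i)\rceil,$$ where $C_{in}(i) = (i, 0 \mid \varepsilon, \Box, \varepsilon \mid s_{in})$ is the initial configuration of $\mathcal M$ on $i$ (the number of steps is a constant independent of $k$ and $i$).
   Context: $\Lambda_{\tt det}$: terms $t ::= v \mid t\,v$, values $v ::= \lambda x.t \mid x$; evaluation contexts $E ::= [\cdot] \mid E\,v$; reduction $E[(\lambda x.t)u] \rightarrow_{det} E[t\{x:=u\}]$. Encodings: for a finite ordered alphabet $\Sigma=\{a_1,\dots,a_m\}$, a character is $\lceil a_j\rceil := \lambda x_1.\ldots\lambda x_m.x_j$, and strings are Scott-encoded: $\lceil\varepsilon\rceil:=\lambda x_1.\ldots\lambda x_m.\lambda x_\varepsilon.x_\varepsilon$, $\lceil a_j r\rceil := \lambda x_1.\ldots\lambda x_m.\lambda x_\varepsilon.x_j\lceil r\rceil$. The alphabets are $\mathbb{B}_I=\{0,1,\mathsf{L},\mathsf{R}\}$ (input tape) and $\mathbb{B}_W=\{0,1,\Box\}$ (work tape, $\Box$ blank), in these orders; $Q$ is a finite ordered set of states. $\mathrm{bin}(n)$ is the reversed binary representation of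 $n$ with no trailing zeros ($\mathrm{bin}(0)=\varepsilon$), Scott-encoded over $\{0,1\}$. A configuration is a tuple $(i, n \mid w_l, a, w_r \mid s)$ with $i\in\mathbb{B}_I^*$ the input, $n\in\mathbb{N}$ the input head position, $w_l,w_r\in\mathbb{B}_W^*$ the work tape left and right of the work head, $a\in\mathbb{B}_W$ the scanned work cell, $s\in Q$; it is encoded as $\lceil (i,n\mid w_l,a,w_r\mid s)\rceil := \lambda x.\,x\,\lceil i\rceil\,\lceil \mathrm{bin}(n)\rceil\,\lceil w_l^{R}\rceil\,\lceil a\rceil\,\lceil w_r\rceil\,\lceil s\rceil$ where $w_l^R$ is $w_l$ reversed. A deterministic binary Turing machine with input is $(Q,s_{in},s_T,s_F,\delta)$ with $Q$ finite, initial state $s_{in}$, final states $s_T,s_F$, and partial transition function $\delta:\mathbb{B}_I\times\mathbb{B}_W\times Q\rightharpoonup\{ -1,+1,0\}\times\mathbb{B}_W\times\{\leftarrow,\rightarrow,\downarrow\}\times Q$ defined only on non-final states. -}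

module Defs where

open import Data.Nat using (ℕ; zero; suc; _+_; _∸_; ⌊_/2⌋)
open import Data.Nat.Base using (_%_)
open import Data.Fin using (Fin; toℕ)
open import Data.Bool using (Bool; true; false; if_then_else_)
open import Data.List using (List; []; _∷_; _++_; map; reverse; [_])
open import Data.Maybe using (Maybe; nothing)
open import Data.Product using (_×_)
open import Relation.Binary.PropositionalEquality using (_≡_)

-- Λ_det, with de Bruijn indices (variables are natural numbers)
--   terms  t ::= v | t v      values v ::= λ.t | x

mutual
  data Term : Set where
    val : Val → Term
    app : Term → Val → Term

  data Val : Set where
    lam : Term → Val
    var : ℕ → Val

ext : (ℕ → ℕ) → ℕ → ℕ
ext ρ zero    = zero
ext ρ (suc n) = suc (ρ n)

mutual
  renT : (ℕ → ℕ) → Term → Term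
  renT ρ (val v)   = val (renV ρ v)
  renT ρ (app t v) = app (renT ρ t) (renV ρ v)

  renV : (ℕ → ℕ) → Val → Val
  renV ρ (lam t) = lam (renT (ext ρ) t)
  renV ρ (var n) = var (ρ n)

exts : (ℕ → Val) → ℕ → Val
exts σ zero    = var zero
exts σ (suc n) = renV suc (σ n)

mutual
  subT : (ℕ → Val) → Term → Term
  subT σ (val v)   = val (subV σ v)
  subT σ (app t v) = app (subT σ t) (subV σ v)

  subV : (ℕ → Val) → Val → Val
  subV σ (lam t) = lam (subT (exts σ) t)
  subV σ (var n) = σ n

single : Val → ℕ → Val
single u zero    = u
single u (suc n) = var n

-- t{x:=u}, where x is the variable bound by the enclosing λ (index 0)
_⟦_⟧ : Term → Val → Term
t ⟦ u ⟧ = subT (single u) t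

-- deterministic reduction: E[(λx.t)u] → E[t{x:=u}],  E ::= [·] | E v
infix 4 _⟶_
data _⟶_ : Term → Term → Set where
  β   : ∀ {t u} → app (val (lam t)) u ⟶ t ⟦ u ⟧
  ctx : ∀ {t t' v} → t ⟶ t' → app t v ⟶ app t' v

data _⟶[_]_ : Term → ℕ → Term → Set where
  done : ∀ {t} → t ⟶[ 0 ] t
  step : ∀ {t t' t'' n} → t ⟶ t' → t' ⟶[ n ] t'' → t ⟶[ suc n ] t''

-- Encodings over an ordered alphabet {a_0,...,a_{m-1}} (0-based j)

lams : ℕ → Term → Term
lams zero    t = t
lams (suc m) t = val (lam (lams m t))

-- ⌈a_j⌉ = λx_1...λx_m. x_j
encChar : (m : ℕ) → Fin m → Val
encChar zero    ()
encChar (suc m) j = lam (lams m (val (var (m ∸ toℕ j))))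

-- Scott encoding of strings
encStr : (m : ℕ) → List (Fin m) → Val
encStr m []      = lam (lams m (val (var zero)))
encStr m (j ∷ r) = lam (lams m (app (val (var (m ∸ toℕ j))) (encStr m r)))

data BI : Set where
  i0 i1 iL iR : BI

data BW : Set where
  w0 w1 wB : BW

BI→Fin : BI → Fin 4
BI→Fin i0 = Fin.zero
BI→Fin i1 = Fin.suc Fin.zero
BI→Fin iL = Fin.suc (Fin.suc Fin.zero)
BI→Fin iR = Fin.suc (Fin.suc (Fin.suc Fin.zero))

BW→Fin : BW → Fin 3
BW→Fin w0 = Fin.zero
BW→Fin w1 = Fin.suc Fin.zero
BW→Fin wB = Fin.suc (Fin.suc Fin.zero)

Bit→Fin : Bool → Fin 2
Bit→Fin false = Fin.zero
Bit→Fin true  = Fin.suc Fin.zero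

-- bin(n): reversed binary representation (least significant bit first),
-- no trailing zeros; bin 0 = ε.  (Fuel-based; fuel n suffices.)
binF : ℕ → ℕ → List Bool
binF zero    _       = []
binF (suc f) zero    = []
binF (suc f) (suc n) = (if (suc n % 2) Data.Nat.≡ᵇ 1 then true else false) ∷ binF f ⌊ suc n /2⌋
  where import Data.Nat

bin : ℕ → List Bool
bin n = binF n n

data InMove : Set where
  -1ᵢ +1ᵢ 0ᵢ : InMove

data WMove : Set where
  ←ʷ →ʷ ↓ʷ : WMove

record TM : Set where
  field
    nQ   : ℕ                         -- Q = Fin nQ, ordered
    s-in s-T s-F : Fin nQ
    δ    : BI → BW → Fin nQ → Maybe (InMove × BW × WMove × Fin nQ)
    δ-final-T : ∀ a b → δ a b s-T ≡ nothing
    δ-final-F : ∀ a b → δ a b s-F ≡ nothing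

record Config (M : TM) : Set where
  constructor ⟨_,_∣_,_,_∣_⟩
  field
    input : List BI
    pos   : ℕ
    wl    : List BW
    a     : BW
    wr    : List BW
    st    : Fin (TM.nQ M)

encConfig : (M : TM) → Config M → Val
encConfig M ⟨ i , n ∣ wl , a , wr ∣ s ⟩ =
  lam (app (app (app (app (app (app (val (var zero))
        (encStr 4 (map BI→Fin i)))
        (encStr 2 (map Bit→Fin (bin n))))
        (encStr 3 (map BW→Fin (reverse wl))))
        (encChar 3 (BW→Fin a)))
        (encStr 3 (map BW→Fin wr)))
        (encChar (TM.nQ M) s))

Cin : (M : TM) → List BI → Config M
Cin M i = ⟨ i , 0 ∣ [] , wB , [] ∣ TM.s-in M ⟩

bitToBI : Bool → BI
bitToBI false = i0
bitToBI true  = i1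

wrapInput : List Bool → List BI
wrapInput s = iL ∷ map bitToBI s ++ [ iR ]

module Submission where

-- The machine-independent part of the initial configuration is a fixed closed value, so
--   init := λk.λi. k (λx. x i ⌈bin 0⌉ ⌈ε⌉ ⌈□⌉ ⌈ε⌉ ⌈s_in⌉)
-- reaches k ⌈C_in(i)⌉ in exactly two β-steps. The only work is to show that these
-- substitutions leave the Scott encodings untouched, which holds because they are closed.

open import Defs
open import Data.Nat using (ℕ; zero; suc; _+_; _<_; _≤_; z≤n; s≤s)
open import Data.Nat.Properties using (+-identityʳ; +-suc; m∸n≤m; ≤-trans)
open import Data.Bool using (Bool)
open import Data.List using (List; []; _∷_; map)
open import Data.Fin using (toℕ)
open import Data.Product using (Σ; _,_)
open import Relation.Binary.PropositionalEquality using (_≡_; refl; cong; cong₂; subst; module ≡-Reasoning)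

mutual
  subT-renT-cancel : ∀ σ ρ → (∀ n → σ (ρ n) ≡ var n) → ∀ t → subT σ (renT ρ t) ≡ t
  subT-renT-cancel σ ρ e (val v)   = cong val (subV-renV-cancel σ ρ e v)
  subT-renT-cancel σ ρ e (app t v) = cong₂ app (subT-renT-cancel σ ρ e t) (subV-renV-cancel σ ρ e v)

  subV-renV-cancel : ∀ σ ρ → (∀ n → σ (ρ n) ≡ var n) → ∀ v → subV σ (renV ρ v) ≡ v
  subV-renV-cancel σ ρ e (lam t) = cong lam (subT-renT-cancel (exts σ) (ext ρ) e′ t)
    where
      e′ : ∀ n → exts σ (ext ρ n) ≡ var n
      e′ zero    = refl
      e′ (suc n) = cong (renV suc) (e n)
  subV-renV-cancel σ ρ e (var n) = e n

single-renV-suc : ∀ u v → subV (single u) (renV suc v) ≡ v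
single-renV-suc u = subV-renV-cancel (single u) suc (λ n → refl)

mutual
  data ScopedT (b : ℕ) : Term → Set where
    val : ∀ {v} → ScopedV b v → ScopedT b (val v)
    app : ∀ {t v} → ScopedT b t → ScopedV b v → ScopedT b (app t v)

  data ScopedV (b : ℕ) : Val → Set where
    lam : ∀ {t} → ScopedT (suc b) t → ScopedV b (lam t)
    var : ∀ {n} → n < b → ScopedV b (var n)

Closed : Val → Set
Closed = ScopedV 0

mutual
  ScopedT-weaken : ∀ {b c t} → b ≤ c → ScopedT b t → ScopedT c t
  ScopedT-weaken b≤c (val v)   = val (ScopedV-weaken b≤c v)
  ScopedT-weaken b≤c (app t v) = app (ScopedT-weaken b≤c t) (ScopedV-weaken b≤c v)

  ScopedV-weaken : ∀ {b c v} → b ≤ c → ScopedV b v → ScopedV c v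
  ScopedV-weaken b≤c (lam t)   = lam (ScopedT-weaken (s≤s b≤c) t)
  ScopedV-weaken b≤c (var n<b) = var (≤-trans n<b b≤c)

mutual
  subT-scoped-id : ∀ {b σ t} → (∀ n → n < b → σ n ≡ var n) → ScopedT b t → subT σ t ≡ t
  subT-scoped-id e (val v)   = cong val (subV-scoped-id e v)
  subT-scoped-id e (app t v) = cong₂ app (subT-scoped-id e t) (subV-scoped-id e v)

  subV-scoped-id : ∀ {b σ v} → (∀ n → n < b → σ n ≡ var n) → ScopedV b v → subV σ v ≡ v
  subV-scoped-id {b} {σ} e (lam t) = cong lam (subT-scoped-id e′ t)
    where
      e′ : ∀ n → n < suc b → exts σ n ≡ var n
      e′ zero    _         = refl
      e′ (suc n) (s≤s n<b) = cong (renV suc) (e n n<b)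
  subV-scoped-id e (var n<b) = e _ n<b

mutual
  renT-scoped-id : ∀ {b ρ t} → (∀ n → n < b → ρ n ≡ n) → ScopedT b t → renT ρ t ≡ t
  renT-scoped-id e (val v)   = cong val (renV-scoped-id e v)
  renT-scoped-id e (app t v) = cong₂ app (renT-scoped-id e t) (renV-scoped-id e v)

  renV-scoped-id : ∀ {b ρ v} → (∀ n → n < b → ρ n ≡ n) → ScopedV b v → renV ρ v ≡ v
  renV-scoped-id {b} {ρ} e (lam t) = cong lam (renT-scoped-id e′ t)
    where
      e′ : ∀ n → n < suc b → ext ρ n ≡ n
      e′ zero    _         = refl
      e′ (suc n) (s≤s n<b) = cong suc (e n n<b)
  renV-scoped-id e (var n<b) = cong var (e _ n<b)

subV-closed : ∀ σ {v} → Closed v → subV σ v ≡ v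
subV-closed σ = subV-scoped-id (λ n ())

renV-closed : ∀ ρ {v} → Closed v → renV ρ v ≡ v
renV-closed ρ = renV-scoped-id (λ n ())

lams-scoped : ∀ m {b t} → ScopedT (b + m) t → ScopedT b (lams m t)
lams-scoped zero    {b} {t} sc = subst (λ c → ScopedT c t) (+-identityʳ b) sc
lams-scoped (suc m) {b} {t} sc = val (lam (lams-scoped m (subst (λ c → ScopedT c t) (+-suc b m) sc)))

encChar-closed : ∀ m j → Closed (encChar m j)
encChar-closed (suc m) j = lam (lams-scoped m (val (var (s≤s (m∸n≤m m (toℕ j))))))

encStr-closed : ∀ m l → Closed (encStr m l)
encStr-closed m []      = lam (lams-scoped m (val (var (s≤s z≤n))))
encStr-closed m (j ∷ r) =
  lam (lams-scoped m (app (val (var (s≤s (m∸n≤m m (toℕ j))))) (ScopedV-weaken z≤n (encStr-closed m r))))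

⟶[0]-reflexive : ∀ {t t′} → t ≡ t′ → t ⟶[ 0 ] t′
⟶[0]-reflexive refl = done

-- ⌈C_in(i)⌉ with ⌈i⌉ replaced by I; note that I sits under the binder of the tuple.
initialConfig : (M : TM) → Val → Val
initialConfig M I =
  lam (app (app (app (app (app (app (val (var zero))
    I) (encStr 2 [])) (encStr 3 [])) (encChar 3 (BW→Fin wB))) (encStr 3 [])) (encChar (TM.nQ M) (TM.s-in M)))

initialConfig-subV : ∀ M σ I → subV σ (initialConfig M I) ≡ initialConfig M (subV (exts σ) I)
initialConfig-subV M σ I =
  cong (λ S → lam (app (app (app (app (app (app (val (var zero))
    (subV (exts σ) I)) (encStr 2 [])) (encStr 3 [])) (encChar 3 (BW→Fin wB))) (encStr 3 [])) S))
    (subV-closed (exts σ) (encChar-closed (TM.nQ M) (TM.s-in M)))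

init : TM → Term
init M = val (lam (val (lam (app (val (var 1)) (initialConfig M (var 1))))))

init-reduces : ∀ M k i → app (app (init M) k) (encStr 4 (map BI→Fin i)) ⟶[ 2 ] app (val k) (encConfig M (Cin M i))
init-reduces M k i = step (ctx β) (step β (⟶[0]-reflexive (cong₂ app (cong val (single-renV-suc I k)) config-eq)))
  where
    I : Val
    I = encStr 4 (map BI→Fin i)

    config-eq : subV (single I) (subV (exts (single k)) (initialConfig M (var 1))) ≡ initialConfig M I
    config-eq = begin
      subV (single I) (subV (exts (single k)) (initialConfig M (var 1)))
        ≡⟨ cong (subV (single I)) (initialConfig-subV M (exts (single k)) (var 1)) ⟩
      subV (single I) (initialConfig M (var 1))
        ≡⟨ initialConfig-subV M (single I) (var 1) ⟩
      initialConfig M (renV suc I)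
        ≡⟨ cong (initialConfig M) (renV-closed suc (encStr-closed 4 (map BI→Fin i))) ⟩
      initialConfig M I
        ∎
      where open ≡-Reasoning

mainTheorem6 : (M : TM) → Σ Term λ init → Σ ℕ λ c →
                 (k : Val) (s : List Bool) →
                 app (app init k) (encStr 4 (map BI→Fin (wrapInput s)))
                   ⟶[ c ] app (val k) (encConfig M (Cin M (wrapInput s)))
mainTheorem6 M = init M , 2 , λ k s → init-reduces M k (wrapInput s)
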